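{- Let $n\ge 3$ and let $(C_n,L)$ be an edge-labeled $n$-cycle with positive integer edge labels $\ell_1,\dots,\ell_n$. Let $\mathcal{G}_0=(1,\dots,1)$ and, for each $1\le k\le n-1$, let $\mathcal{G}_k$ be a smallest flow-up class $\mathcal{G}_k$ on $(C_n,L)$. Then $\mathcal{G}_0,\mathcal{G}_1,\dots,\mathcal{G}_{n-1}$ form a basis over $\mathbb{Z}$ of the $\mathbb{Z}$-module of generalized splines on $(C_n,L)$.
   Context: An edge-labeled $n$-cycle $(C_n,L)$: vertices $v_1,\dots,v_n$; edge $e_i$ joins $v_i$ and $v_{i+1}$ for $1\le i\le n-1$, and $e_n$ joins $v_n$ and $v_1$; edge $e_i$ carries label $\ell_i$. A generalized spline on $(C_n,L)$ is a tuple $(g_1,\dots,g_n)\in\mathbb{Z}^n$ with $g_i\equiv g_{i+1}\pmod{\ell_i}$ for $1\le i\le n-1$ and $g_n\equiv g_1\pmod{\ell_n}$; the splines form a $\mathbb{Z}$-module under componentwise operations. For $1\le k<n$, a flow-up class $\mathcal{G}_k$ is a spline $(0,\dots,0,g_{k+1},\dots,g_n)$ with $k$ leading zeros and $g_{k+1}\ne 0$. A smallest flow-up class $\mathcal{G}_k=(0,\dots,0,g_{k+1},\dots,g_n)$ is a flow-up class whose nonzero entries are positive and such that for every flow-up class $(0,\dots,0,g'_{k+1},\dots,g'_n)$ with positive entries one has $g'_i\ge g_i$ for all $i$. -}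

module Defs where

open import Data.Nat as ℕ using (ℕ; zero; suc)
open import Data.Nat.DivMod using (_%_; m%n<n)
open import Data.Fin using (Fin; toℕ; fromℕ<)
import Data.Fin as Fin
open import Data.Integer using (ℤ; +_; _-_; _*_; _+_; _≤_; _<_; 0ℤ)
open import Data.Integer.Divisibility using (_∣_)
open import Data.Product using (_×_; ∃)
open import Relation.Binary.PropositionalEquality using (_≡_; _≢_)

-- Vertices v_1..v_n are Fin n (0-based); edge i joins vertex i and
-- vertex (i+1) mod n, so edge n-1 (paper: e_n) joins v_n and v_1.
next : ∀ {n} → Fin n → Fin n
next {suc m} i = fromℕ< (m%n<n (suc (toℕ i)) (suc m))

-- Edge labels ℓ : Fin n → ℕ (positivity is a hypothesis of the theorem).
-- A generalized spline: g i ≡ g (i+1 mod n) modulo ℓ i, in ℤ.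
IsSpline : ∀ {n} → (Fin n → ℕ) → (Fin n → ℤ) → Set
IsSpline ℓ g = ∀ i → (+ ℓ i) ∣ (g i - g (next i))

-- Flow-up class G_k (paper index k, 1 ≤ k < n): entries at 0-based
-- positions < k are zero, the entry at 0-based position k is nonzero.
IsFlowUp : ∀ {n} → (Fin n → ℕ) → ℕ → (Fin n → ℤ) → Set
IsFlowUp ℓ k g =
  IsSpline ℓ g
  × (∀ i → toℕ i ℕ.< k → g i ≡ 0ℤ)
  × (∀ i → toℕ i ≡ k → g i ≢ 0ℤ)

-- The entries g_{k+1},...,g_n (0-based positions ≥ k) are positive.
PositiveTail : ∀ {n} → ℕ → (Fin n → ℤ) → Set
PositiveTail k g = ∀ i → k ℕ.≤ toℕ i → + 0 < g i

IsSmallestFlowUp : ∀ {n} → (Fin n → ℕ) → ℕ → (Fin n → ℤ) → Set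
IsSmallestFlowUp ℓ k g =
  IsFlowUp ℓ k g × PositiveTail k g
  × (∀ g' → IsFlowUp ℓ k g' → PositiveTail k g' → ∀ i → g i ≤ g' i)

linComb : ∀ {m n} → (Fin m → ℤ) → (Fin m → Fin n → ℤ) → Fin n → ℤ
linComb {zero}  c v i = 0ℤ
linComb {suc m} c v i = c Fin.zero * v Fin.zero i + linComb (λ j → c (Fin.suc j)) (λ j → v (Fin.suc j)) i

IsSplineBasis : ∀ {n m} → (Fin n → ℕ) → (Fin m → Fin n → ℤ) → Set
IsSplineBasis ℓ G =
  (∀ k → IsSpline ℓ (G k))
  × (∀ s → IsSpline ℓ s → ∃ λ c → ∀ i → s i ≡ linComb c G i)
  × (∀ c → (∀ i → linComb c G i ≡ 0ℤ) → ∀ j → c j ≡ 0ℤ)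

{-# OPTIONS --safe #-}
module Submission where

-- The family is triangular: G k vanishes below k and has a positive pivot
-- G k k, which gives linear independence.  For spanning it suffices that the
-- pivot divides the k-th entry of every spline vanishing below k; subtracting
-- multiples of G 0, G 1, … then clears any spline entry by entry.  These k-th
-- entries form a subgroup of ℤ, so it suffices that the pivot is its least
-- positive element.  A spline vanishing below k with a smaller positive k-th
-- entry would, after adding a large multiple of G (k+1) (which vanishes up to
-- k and is positive beyond; at the last index nothing needs adding), be a
-- flow-up class with positive entries undercutting G k at k.

open import Defs
open import Data.Nat as ℕ using (ℕ; _≤_; _<_; zero; suc; z≤n; s≤s; _⊔_)
import Data.Nat.Properties as ℕ
open import Data.Fin as Fin using (Fin; toℕ; fromℕ<)
open import Data.Fin.Properties using (toℕ-injective; toℕ<n; toℕ-fromℕ<; suc-injective)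
open import Data.Integer as ℤ
  using (ℤ; +_; +[1+_]; -[1+_]; 0ℤ; ∣_∣; _+_; _*_; -_; _-_; +<+)
import Data.Integer.Properties as ℤ
open import Data.Integer.DivMod using (_/_; _%_; a≡a%n+[a/n]*n; n%d<d)
open import Data.Integer.Divisibility.Signed
  using (_∣_; divides; ∣ᵤ⇒∣; ∣⇒∣ᵤ; ∣m∣n⇒∣m+n; ∣n⇒∣m*n)
open import Data.Integer.Tactic.RingSolver using (solve-∀)
open import Data.Vec.Functional using (updateAt; replicate)
open import Data.Vec.Functional.Properties using (updateAt-updates; updateAt-minimal)
open import Data.Product using (_×_; _,_; ∃; proj₁; proj₂)
open import Data.Sum using (inj₁; inj₂; [_,_]′)
open import Function using (id; const; flip; _∘_)
open import Relation.Nullary using (contradiction; yes; no)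
open import Relation.Binary.Definitions using (tri<; tri≈; tri>)
open import Relation.Binary.PropositionalEquality
  using (_≡_; _≢_; refl; sym; trans; cong; cong₂; subst; ≢-sym; module ≡-Reasoning)
open ≡-Reasoning

VanishesBelow : ∀ {n} → ℕ → (Fin n → ℤ) → Set
VanishesBelow k g = ∀ i → toℕ i < k → g i ≡ 0ℤ

bounded : ∀ {n} (f : Fin n → ℕ) → ∃ λ B → ∀ i → f i ≤ B
bounded {zero}  f = 0 , λ ()
bounded {suc n} f with B , f∘suc≤B ← bounded (λ i → f (Fin.suc i)) =
  f Fin.zero ⊔ B , λ { Fin.zero    → ℕ.m≤m⊔n _ _
                     ; (Fin.suc i) → ℕ.≤-trans (f∘suc≤B i) (ℕ.m≤n⊔m _ _) }

linComb-≡0 : ∀ {m n} (c : Fin m → ℤ) (v : Fin m → Fin n → ℤ) i →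
             (∀ j → c j * v j i ≡ 0ℤ) → linComb c v i ≡ 0ℤ
linComb-≡0 {zero}  c v i terms≡0 = refl
linComb-≡0 {suc m} c v i terms≡0 =
  cong₂ _+_ (terms≡0 Fin.zero)
            (linComb-≡0 (c ∘ Fin.suc) (v ∘ Fin.suc) i (terms≡0 ∘ Fin.suc))

linComb-≡-term : ∀ {m n} (c : Fin m → ℤ) (v : Fin m → Fin n → ℤ) i k →
                 (∀ j → j ≢ k → c j * v j i ≡ 0ℤ) → linComb c v i ≡ c k * v k i
linComb-≡-term {suc m} c v i Fin.zero others≡0 = begin
  c Fin.zero * v Fin.zero i + linComb (c ∘ Fin.suc) (v ∘ Fin.suc) i
    ≡⟨ cong (λ r → c Fin.zero * v Fin.zero i + r)
            (linComb-≡0 (c ∘ Fin.suc) (v ∘ Fin.suc) i (λ j → others≡0 (Fin.suc j) λ ())) ⟩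
  c Fin.zero * v Fin.zero i + 0ℤ
    ≡⟨ ℤ.+-identityʳ _ ⟩
  c Fin.zero * v Fin.zero i ∎
linComb-≡-term {suc m} c v i (Fin.suc k) others≡0 = begin
  c Fin.zero * v Fin.zero i + linComb (c ∘ Fin.suc) (v ∘ Fin.suc) i
    ≡⟨ cong (_+ linComb (c ∘ Fin.suc) (v ∘ Fin.suc) i) (others≡0 Fin.zero λ ()) ⟩
  0ℤ + linComb (c ∘ Fin.suc) (v ∘ Fin.suc) i
    ≡⟨ ℤ.+-identityˡ _ ⟩
  linComb (c ∘ Fin.suc) (v ∘ Fin.suc) i
    ≡⟨ linComb-≡-term (c ∘ Fin.suc) (v ∘ Fin.suc) i k
                      (λ j j≢k → others≡0 (Fin.suc j) (j≢k ∘ suc-injective)) ⟩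
  c (Fin.suc k) * v (Fin.suc k) i ∎

linComb-distrib-+ : ∀ {m n} (c d : Fin m → ℤ) (v : Fin m → Fin n → ℤ) i →
                    linComb (λ j → c j + d j) v i ≡ linComb c v i + linComb d v i
linComb-distrib-+ {zero}  c d v i = refl
linComb-distrib-+ {suc m} c d v i =
  trans (cong (λ r → (c Fin.zero + d Fin.zero) * v Fin.zero i + r)
              (linComb-distrib-+ (c ∘ Fin.suc) (d ∘ Fin.suc) (v ∘ Fin.suc) i))
        (interchange (c Fin.zero) (d Fin.zero) (v Fin.zero i) _ _)
  where
  interchange : ∀ a b x p q → (a + b) * x + (p + q) ≡ (a * x + p) + (b * x + q)
  interchange = solve-∀

single : ∀ {m} → Fin m → ℤ → Fin m → ℤ
single k q = updateAt (replicate _ 0ℤ) k (const q)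

linComb-single : ∀ {m n} k q (v : Fin m → Fin n → ℤ) i → linComb (single k q) v i ≡ q * v k i
linComb-single k q v i =
  trans (linComb-≡-term (single k q) v i k off-k)
        (cong (_* v k i) (updateAt-updates k (replicate _ 0ℤ)))
  where
  off-k : ∀ j → j ≢ k → single k q j * v j i ≡ 0ℤ
  off-k j j≢k = trans (cong (_* v j i) (updateAt-minimal j k (replicate _ 0ℤ) j≢k))
                      (ℤ.*-zeroˡ (v j i))

triangular⇒independent : ∀ {n} (G : Fin n → Fin n → ℤ) →
                         (∀ k → VanishesBelow (toℕ k) (G k)) → (∀ k → G k k ≢ 0ℤ) →
                         ∀ c → (∀ i → linComb c G i ≡ 0ℤ) → ∀ j → c j ≡ 0ℤ
triangular⇒independent G G-vanishes pivot≢0 c c·G≡0 j = coefficient≡0 (suc (toℕ j)) j (ℕ.n<1+n _)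
  where
  coefficient≡0 : ∀ m j → toℕ j < m → c j ≡ 0ℤ
  coefficient≡0 (suc m) j j<1+m with ℕ.m<1+n⇒m<n∨m≡n j<1+m
  ... | inj₁ j<m  = coefficient≡0 m j j<m
  ... | inj₂ j≡m  = [ id , flip contradiction (pivot≢0 j) ]′ (ℤ.i*j≡0⇒i≡0∨j≡0 (c j) diagonal≡0)
    where
    others≡0 : ∀ i → i ≢ j → c i * G i j ≡ 0ℤ
    others≡0 i i≢j with ℕ.<-cmp (toℕ i) (toℕ j)
    ... | tri< i<j _ _ = cong (_* G i j) (coefficient≡0 m i (subst (toℕ i <_) j≡m i<j))
    ... | tri≈ _ i≡j _ = contradiction (toℕ-injective i≡j) i≢j
    ... | tri> _ _ j<i = trans (cong (c i *_) (G-vanishes i j j<i)) (ℤ.*-zeroʳ (c i))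
    diagonal≡0 : c j * G j j ≡ 0ℤ
    diagonal≡0 = trans (sym (linComb-≡-term c G j j others≡0)) (c·G≡0 j)

constant-isSpline : ∀ {n} {ℓ : Fin n → ℕ} {g : Fin n → ℤ} a → (∀ i → g i ≡ a) → IsSpline ℓ g
constant-isSpline {ℓ = ℓ} {g} a g≡a i = ∣⇒∣ᵤ {+ ℓ i} (divides 0ℤ difference≡0)
  where
  difference≡0 : g i - g (next i) ≡ 0ℤ
  difference≡0 = trans (cong₂ _-_ (g≡a i) (g≡a (next i))) (ℤ.+-inverseʳ a)

+-*-isSpline : ∀ {n} {ℓ : Fin n → ℕ} (g h : Fin n → ℤ) q →
               IsSpline ℓ g → IsSpline ℓ h → IsSpline ℓ (λ i → g i + q * h i)
+-*-isSpline {ℓ = ℓ} g h q g-spline h-spline i =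
  ∣⇒∣ᵤ (subst (+ ℓ i ∣_) (sym (regroup (g i) (g (next i)) (h i) (h (next i)) q))
              (∣m∣n⇒∣m+n (∣ᵤ⇒∣ {+ ℓ i} {g i - g (next i)} (g-spline i))
                          (∣n⇒∣m*n q (∣ᵤ⇒∣ {+ ℓ i} {h i - h (next i)} (h-spline i)))))
  where
  regroup : ∀ a b c d q → (a + q * c) - (b + q * d) ≡ (a - b) + q * (c - d)
  regroup = solve-∀

+-*-vanishesBelow : ∀ {n k} (g h : Fin n → ℤ) q →
                    VanishesBelow k g → VanishesBelow k h → VanishesBelow k (λ i → g i + q * h i)
+-*-vanishesBelow g h q g-vanishes h-vanishes i i<k =
  trans (cong₂ (λ a b → a + q * b) (g-vanishes i i<k) (h-vanishes i i<k))
        (trans (ℤ.+-identityˡ _) (ℤ.*-zeroʳ q))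

least-positive-∣ : (P : ℤ → Set) {d : ℤ} → 0ℤ ℤ.< d →
                   (∀ {x} q → P x → P (x + q * d)) →
                   (∀ {x} → P x → 0ℤ ℤ.< x → d ℤ.≤ x) →
                   ∀ {x} → P x → d ∣ x
least-positive-∣ P {d} 0<d closed least {x} Px = divides (x / d) (begin
  x                  ≡⟨ a≡a%n+[a/n]*n x d ⟩
  + (x % d) + q * d  ≡⟨ cong (λ r → + r + q * d) (remainder≡0 (x % d) P[r] r<d) ⟩
  0ℤ + q * d         ≡⟨ ℤ.+-identityˡ (q * d) ⟩
  q * d              ∎)
  where
  instance
    d≢0 : ℤ.NonZero d
    d≢0 = ℤ.>-nonZero 0<d
  q : ℤ
  q = x / d
  cancel : ∀ r q d → (r + q * d) + (- q) * d ≡ r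
  cancel = solve-∀
  P[r] : P (+ (x % d))
  P[r] = subst P (trans (cong (_+ (- q) * d) (a≡a%n+[a/n]*n x d)) (cancel _ q d)) (closed (- q) Px)
  r<d : + (x % d) ℤ.< d
  r<d = subst (+ (x % d) ℤ.<_) (ℤ.0≤i⇒+∣i∣≡i (ℤ.<⇒≤ 0<d)) (+<+ (n%d<d x d))
  remainder≡0 : ∀ r → P (+ r) → + r ℤ.< d → r ≡ 0
  remainder≡0 zero    _  _   = refl
  remainder≡0 (suc r) Pr r<d = contradiction (least Pr (+<+ (s≤s z≤n))) (ℤ.<⇒≱ r<d)

+-*-positive : ∀ x g B → ∣ x ∣ ≤ B → 0ℤ ℤ.< g → 0ℤ ℤ.< x + +[1+ B ] * g
+-*-positive x        (+ zero) B _   (+<+ ())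
+-*-positive (+ a)    +[1+ g ] B _   _ = +<+ (ℕ.<-≤-trans (s≤s z≤n) (ℕ.m≤n+m _ a))
+-*-positive -[1+ a ] +[1+ g ] B a<B _ =
  subst (0ℤ ℤ.<_) (sym (ℤ.⊖-≥ (ℕ.<⇒≤ a<M))) (+<+ (ℕ.m<n⇒0<n∸m a<M))
  where
  a<M : suc a < suc B ℕ.* suc g
  a<M = ℕ.<-≤-trans (s≤s a<B) (ℕ.m≤m*n (suc B) (suc g))

positivise : ∀ {n} {ℓ : Fin n → ℕ} {m} {p : Fin n → ℤ} →
             IsSpline ℓ p → VanishesBelow m p → PositiveTail m p →
             ∀ {t} → IsSpline ℓ t →
             ∃ λ t′ → IsSpline ℓ t′ × (∀ i → toℕ i < m → t′ i ≡ t i) × PositiveTail m t′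
positivise {m = m} {p} p-spline p-vanishes p-positive {t} t-spline
  with B , ∣t∣≤B ← bounded (∣_∣ ∘ t) =
  (λ i → t i + +[1+ B ] * p i) , +-*-isSpline t p +[1+ B ] t-spline p-spline , unchanged , positive
  where
  unchanged : ∀ i → toℕ i < m → t i + +[1+ B ] * p i ≡ t i
  unchanged i i<m = begin
    t i + +[1+ B ] * p i  ≡⟨ cong (λ y → t i + +[1+ B ] * y) (p-vanishes i i<m) ⟩
    t i + +[1+ B ] * 0ℤ   ≡⟨ cong (λ y → t i + y) (ℤ.*-zeroʳ +[1+ B ]) ⟩
    t i + 0ℤ              ≡⟨ ℤ.+-identityʳ (t i) ⟩
    t i                   ∎
  positive : PositiveTail m (λ i → t i + +[1+ B ] * p i)
  positive i m≤i = +-*-positive (t i) (p i) B (∣t∣≤B i) (p-positive i m≤i)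

record LeastPivotFlowUp {n} (ℓ : Fin n → ℕ) (k : Fin n) (g : Fin n → ℤ) : Set where
  field
    spline         : IsSpline ℓ g
    vanishes       : VanishesBelow (toℕ k) g
    pivot-positive : 0ℤ ℤ.< g k
    pivot-least    : ∀ {t} → IsSpline ℓ t → VanishesBelow (toℕ k) t → 0ℤ ℤ.< t k → g k ℤ.≤ t k

  pivot∣ : ∀ {s} → IsSpline ℓ s → VanishesBelow (toℕ k) s → g k ∣ s k
  pivot∣ {s} s-spline s-vanishes =
    least-positive-∣ Entry pivot-positive closed least (s , s-spline , s-vanishes , refl)
    where
    Entry : ℤ → Set
    Entry x = ∃ λ t → IsSpline ℓ t × VanishesBelow (toℕ k) t × t k ≡ x
    closed : ∀ {x} q → Entry x → Entry (x + q * g k)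
    closed q (t , t-spline , t-vanishes , refl) =
      (λ i → t i + q * g i) , +-*-isSpline t g q t-spline spline ,
      +-*-vanishesBelow t g q t-vanishes vanishes , refl
    least : ∀ {x} → Entry x → 0ℤ ℤ.< x → g k ℤ.≤ x
    least (t , t-spline , t-vanishes , refl) = pivot-least t-spline t-vanishes

ones⇒leastPivotFlowUp : ∀ {n} {ℓ : Fin (suc n) → ℕ} {g} → (∀ i → g i ≡ + 1) →
                        LeastPivotFlowUp ℓ Fin.zero g
ones⇒leastPivotFlowUp {g = g} g≡1 = record
  { spline         = constant-isSpline (+ 1) g≡1
  ; vanishes       = λ i ()
  ; pivot-positive = subst (0ℤ ℤ.<_) (sym (g≡1 Fin.zero)) (+<+ (s≤s z≤n))
  ; pivot-least    = λ _ _ 0<t → subst (ℤ._≤ _) (sym (g≡1 Fin.zero)) (ℤ.i<j⇒suc[i]≤j 0<t)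
  }

smallest⇒leastPivotFlowUp : ∀ {n} {ℓ : Fin n → ℕ} {k g} → IsSmallestFlowUp ℓ (toℕ k) g →
                            (∃ λ p → IsSpline ℓ p × VanishesBelow (suc (toℕ k)) p ×
                                     PositiveTail (suc (toℕ k)) p) →
                            LeastPivotFlowUp ℓ k g
smallest⇒leastPivotFlowUp {ℓ = ℓ} {k} {g} ((g-spline , g-vanishes , _) , g-positive , g-least)
                          (p , p-spline , p-vanishes , p-positive) = record
  { spline         = g-spline
  ; vanishes       = g-vanishes
  ; pivot-positive = g-positive k ℕ.≤-refl
  ; pivot-least    = pivot-least
  }
  where
  pivot-least : ∀ {t} → IsSpline ℓ t → VanishesBelow (toℕ k) t → 0ℤ ℤ.< t k → g k ℤ.≤ t k
  pivot-least {t} t-spline t-vanishes 0<tk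
    with t′ , t′-spline , t′≡t , t′-positive ← positivise p-spline p-vanishes p-positive t-spline =
    subst (g k ℤ.≤_) t′k≡tk (g-least t′ t′-flowUp t′-positiveTail k)
    where
    t′k≡tk : t′ k ≡ t k
    t′k≡tk = t′≡t k (ℕ.n<1+n (toℕ k))
    0<t′k : 0ℤ ℤ.< t′ k
    0<t′k = subst (0ℤ ℤ.<_) (sym t′k≡tk) 0<tk
    t′-flowUp : IsFlowUp ℓ (toℕ k) t′
    t′-flowUp = t′-spline
              , (λ i i<k → trans (t′≡t i (ℕ.m<n⇒m<1+n i<k)) (t-vanishes i i<k))
              , (λ i i≡k → subst (λ j → t′ j ≢ 0ℤ) (toℕ-injective (sym i≡k)) (≢-sym (ℤ.<⇒≢ 0<t′k)))
    t′-positiveTail : PositiveTail (toℕ k) t′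
    t′-positiveTail i k≤i with ℕ.m≤n⇒m<n∨m≡n k≤i
    ... | inj₁ k<i = t′-positive i k<i
    ... | inj₂ k≡i = subst (λ j → 0ℤ ℤ.< t′ j) (toℕ-injective k≡i) 0<t′k

module _ {n} {ℓ : Fin n → ℕ} {G : Fin n → Fin n → ℤ}
         (G-least : ∀ k → LeastPivotFlowUp ℓ k (G k)) where

  open LeastPivotFlowUp

  spans-vanishingBelow : ∀ r {k} → r ℕ.+ k ≡ n → ∀ {s} → IsSpline ℓ s → VanishesBelow k s →
                         ∃ λ c → ∀ i → s i ≡ linComb c G i
  spans-vanishingBelow zero    r+k≡n {s} _ s-vanishes = (λ _ → 0ℤ) , λ i →
    trans (s-vanishes i (subst (toℕ i <_) (sym r+k≡n) (toℕ<n i)))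
          (sym (linComb-≡0 (λ _ → 0ℤ) G i (λ _ → refl)))
  spans-vanishingBelow (suc r) {k} r+k≡n {s} s-spline s-vanishes =
    (λ j → c j + single kf q j) , λ i → begin
      s i                                        ≡⟨ split (s i) q (G kf i) ⟩
      t i + q * G kf i                           ≡⟨ cong₂ _+_ (t≡c·G i) (sym (linComb-single kf q G i)) ⟩
      linComb c G i + linComb (single kf q) G i  ≡⟨ linComb-distrib-+ c (single kf q) G i ⟨
      linComb (λ j → c j + single kf q j) G i    ∎
    where
    k<n : k < n
    k<n = subst (k <_) r+k≡n (s≤s (ℕ.m≤n+m k r))
    kf : Fin n
    kf = fromℕ< k<n
    toℕ-kf : toℕ kf ≡ k
    toℕ-kf = toℕ-fromℕ< k<n
    s-vanishes′ : VanishesBelow (toℕ kf) s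
    s-vanishes′ = subst (λ m → VanishesBelow m s) (sym toℕ-kf) s-vanishes
    open _∣_ (pivot∣ (G-least kf) s-spline s-vanishes′) renaming (quotient to q; equality to s-kf≡q*pivot)
    t : Fin n → ℤ
    t i = s i + (- q) * G kf i
    split : ∀ a q g → a ≡ (a + (- q) * g) + q * g
    split = solve-∀
    cancel : ∀ q g → q * g + (- q) * g ≡ 0ℤ
    cancel = solve-∀
    t-kf≡0 : t kf ≡ 0ℤ
    t-kf≡0 = trans (cong (λ a → a + (- q) * G kf kf) s-kf≡q*pivot) (cancel q (G kf kf))
    t-vanishes : VanishesBelow (suc k) t
    t-vanishes i i<1+k with ℕ.m<1+n⇒m<n∨m≡n i<1+k
    ... | inj₁ i<k = +-*-vanishesBelow s (G kf) (- q) s-vanishes′ (vanishes (G-least kf))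
                                       i (subst (toℕ i <_) (sym toℕ-kf) i<k)
    ... | inj₂ i≡k = subst (λ j → t j ≡ 0ℤ) (toℕ-injective (trans toℕ-kf (sym i≡k))) t-kf≡0
    spanned : ∃ λ c → ∀ i → t i ≡ linComb c G i
    spanned = spans-vanishingBelow r (trans (ℕ.+-suc r k) r+k≡n)
                (+-*-isSpline s (G kf) (- q) s-spline (spline (G-least kf))) t-vanishes
    c : Fin n → ℤ
    c = proj₁ spanned
    t≡c·G : ∀ i → t i ≡ linComb c G i
    t≡c·G = proj₂ spanned

  leastPivotFlowUps⇒isSplineBasis : IsSplineBasis ℓ G
  leastPivotFlowUps⇒isSplineBasis =
    (λ k → spline (G-least k)) ,
    (λ s s-spline → spans-vanishingBelow n (ℕ.+-identityʳ n) s-spline (λ _ ())) ,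
    triangular⇒independent G (vanishes ∘ G-least) (λ k → ≢-sym (ℤ.<⇒≢ (pivot-positive (G-least k))))

theorem4p7 : (n : ℕ) → 3 ≤ n
    → (ℓ : Fin n → ℕ) → (∀ i → 0 < ℓ i)
    → (G : Fin n → Fin n → ℤ)
    → (∀ k → toℕ k ≡ 0 → ∀ i → G k i ≡ + 1)
    → (∀ k → 1 ≤ toℕ k → IsSmallestFlowUp ℓ (toℕ k) (G k))
    → IsSplineBasis ℓ G
theorem4p7 n _ ℓ _ G G₀≡1 G-smallest = leastPivotFlowUps⇒isSplineBasis G-least
  where
  smallestAt : ∀ {m} (m<n : m < n) → 1 ≤ m → IsSmallestFlowUp ℓ m (G (fromℕ< m<n))
  smallestAt m<n 1≤m =
    subst (λ j → IsSmallestFlowUp ℓ j (G (fromℕ< m<n))) (toℕ-fromℕ< m<n)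
          (G-smallest _ (subst (1 ≤_) (sym (toℕ-fromℕ< m<n)) 1≤m))
  positiveBeyond : (k : Fin n) → ∃ λ p → IsSpline ℓ p × VanishesBelow (suc (toℕ k)) p ×
                                          PositiveTail (suc (toℕ k)) p
  positiveBeyond k with suc (toℕ k) ℕ.<? n
  ... | yes k+1<n with (p-spline , p-vanishes , _) , p-positive , _ ← smallestAt k+1<n (s≤s z≤n) =
    G (fromℕ< k+1<n) , p-spline , p-vanishes , p-positive
  ... | no k+1≮n =
    (λ _ → 0ℤ) , constant-isSpline 0ℤ (λ _ → refl) , (λ _ _ → refl) ,
    λ i k+1≤i → contradiction (ℕ.≤-<-trans k+1≤i (toℕ<n i)) k+1≮n
  G-least : ∀ k → LeastPivotFlowUp ℓ k (G k)
  G-least Fin.zero      = ones⇒leastPivotFlowUp (G₀≡1 Fin.zero refl)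
  G-least k@(Fin.suc _) = smallest⇒leastPivotFlowUp (G-smallest k (s≤s z≤n)) (positiveBeyond k)
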